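{- Consider the game Slow Exact $k$-Nim $\text{Nim}^1_{3,=2}$: three piles, positions $(x_1,x_2,x_3)$ with $0\le x_1\le x_2\le x_3$ (reordered after each move), and by one move a player chooses exactly $2$ non-empty piles and removes exactly one token from each; the player making the last move wins (normal play). Set $A=\{(2a,2b-1,2(b+i))\mid 0\le a<b,\ 0\le i<a,\ (a+i)\bmod 2=1\}$, $B=\{(2a,2b,2(b+i)+1)\mid 0\le a\le b,\ 0\le i<a,\ (a+i)\bmod 2=1\}$, $C_0=\{(2a-1,2b-1,2(b+i)-1)\mid 0\le a\le b,\ 0\le i<a,\ (a+i)\bmod 2=0\}$, $C_1=\{(2a-1,2b-1,2(b+i)-1)\mid 0\le a\le b,\ 0\le i<a,\ (a+i)\bmod 2=1\}$, $D_0=\{(2a-1,2b,2(b+i))\mid 0\le a<b,\ 0\le i<a,\ (a+i)\bmod 2=1\}$, $D_1=\{(2a-1,2b,2(b+i))\mid 0\le a<b,\ 0\le i<a,\ (a+i)\bmod 2=0\}$, $C=C_0\cup C_1$, $D=D_0\cup D_1$. Then the Sprague-Grundy function of this game takes only the values $0,1,2,3$, and the sets of its $i$-positions are: $S_0=(\{(2a,2b,c)\mid 2a\le 2b\le c\}\setminus B)\cup A\cup C_0\cup D_0$, $S_1=(\{(2a,2b+1,c)\mid 2a\le 2b+1\le c\}\setminus A)\cup B\cup C_1\cup D_1$, $S_2=\{(2a+1,2b+1,c)\mid 2a+1\le 2b+1\le c\}\setminus C$, $S_3=\{(2a+1,2b,c)\mid 2a+1\le 2b\le c\}\setminus D$.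 -}

module Defs where

open import Data.Nat using (ℕ; zero; suc; _+_; _*_; _∸_; _≤_; _<_; _≟_)
open import Data.Nat.DivMod using (_%_)
open import Data.List using (List; []; _∷_; _++_; length)
open import Data.Product using (_×_; _,_; ∃-syntax)
open import Data.Sum using (_⊎_)
open import Data.Bool using (Bool; true; false; if_then_else_)
open import Relation.Nullary using (¬_; does)
open import Relation.Binary.PropositionalEquality using (_≡_)

elem : ℕ → List ℕ → Bool
elem n []       = false
elem n (m ∷ ms) = if does (n ≟ m) then true else elem n ms

-- mexFrom l f n : the least k ≥ n, k ≤ n + f, with k ∉ l (or n + f).
mexFrom : List ℕ → ℕ → ℕ → ℕ
mexFrom l zero    n = n
mexFrom l (suc f) n = if elem n l then mexFrom l f (suc n) else n

-- mex l = least natural number not occurring in l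
-- (fuel length l suffices: some k ≤ length l is missing from l).
mex : List ℕ → ℕ
mex l = mexFrom l (length l) 0

-- A position is a triple of pile sizes; a move picks exactly two
-- non-empty piles and removes exactly one token from each.
-- (Reordering the piles does not change the game, so we work with
-- unordered-in-storage triples; the statement restricts to sorted ones.)

mutual
  sg : ℕ → ℕ → ℕ → ℕ
  sg x y z = mex (options x y z)

  options : ℕ → ℕ → ℕ → List ℕ
  options x y z = opt12 x y z ++ (opt13 x y z ++ opt23 x y z)

  opt12 : ℕ → ℕ → ℕ → List ℕ
  opt12 (suc x) (suc y) z = sg x y z ∷ []
  opt12 _       _       _ = []

  opt13 : ℕ → ℕ → ℕ → List ℕ
  opt13 (suc x) y (suc z) = sg x y z ∷ []
  opt13 _       _ _       = []

  opt23 : ℕ → ℕ → ℕ → List ℕ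
  opt23 x (suc y) (suc z) = sg x y z ∷ []
  opt23 _ _       _       = []

Pos : Set
Pos = ℕ × ℕ × ℕ

Pred : Set₁
Pred = Pos → Set

InA : Pred
InA (x , y , z) = ∃[ a ] ∃[ b ] ∃[ i ]
  (a < b × i < a × (a + i) % 2 ≡ 1 ×
   x ≡ 2 * a × y ≡ 2 * b ∸ 1 × z ≡ 2 * (b + i))

InB : Pred
InB (x , y , z) = ∃[ a ] ∃[ b ] ∃[ i ]
  (a ≤ b × i < a × (a + i) % 2 ≡ 1 ×
   x ≡ 2 * a × y ≡ 2 * b × z ≡ 2 * (b + i) + 1)

InCr : ℕ → Pred
InCr r (x , y , z) = ∃[ a ] ∃[ b ] ∃[ i ]
  (a ≤ b × i < a × (a + i) % 2 ≡ r ×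
   x ≡ 2 * a ∸ 1 × y ≡ 2 * b ∸ 1 × z ≡ 2 * (b + i) ∸ 1)

InC₀ InC₁ InC : Pred
InC₀ = InCr 0
InC₁ = InCr 1
InC p = InC₀ p ⊎ InC₁ p

-- D_0 = {(2a-1,2b,2(b+i)) | 0≤a≤b, 0≤i<a, (a+i) mod 2 = 1}
-- D_1 = {(2a-1,2b,2(b+i)) | 0≤a≤b, 0≤i<a, (a+i) mod 2 = 0}
-- (the paper prints 0≤a<b here; that is a typo)
InDr : ℕ → Pred
InDr r (x , y , z) = ∃[ a ] ∃[ b ] ∃[ i ]
  (a ≤ b × i < a × (a + i) % 2 ≡ r ×
   x ≡ 2 * a ∸ 1 × y ≡ 2 * b × z ≡ 2 * (b + i))

InD₀ InD₁ InD : Pred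
InD₀ = InDr 1
InD₁ = InDr 0
InD p = InD₀ p ⊎ InD₁ p

EvenEven : Pred
EvenEven (x , y , z) = ∃[ a ] ∃[ b ] ∃[ c ]
  (2 * a ≤ 2 * b × 2 * b ≤ c × x ≡ 2 * a × y ≡ 2 * b × z ≡ c)

EvenOdd : Pred
EvenOdd (x , y , z) = ∃[ a ] ∃[ b ] ∃[ c ]
  (2 * a ≤ 2 * b + 1 × 2 * b + 1 ≤ c × x ≡ 2 * a × y ≡ 2 * b + 1 × z ≡ c)

OddOdd : Pred
OddOdd (x , y , z) = ∃[ a ] ∃[ b ] ∃[ c ]
  (2 * a + 1 ≤ 2 * b + 1 × 2 * b + 1 ≤ c × x ≡ 2 * a + 1 × y ≡ 2 * b + 1 × z ≡ c)

OddEven : Pred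
OddEven (x , y , z) = ∃[ a ] ∃[ b ] ∃[ c ]
  (2 * a + 1 ≤ 2 * b × 2 * b ≤ c × x ≡ 2 * a + 1 × y ≡ 2 * b × z ≡ c)

S₀ S₁ S₂ S₃ : Pred
S₀ p = (EvenEven p × ¬ InB p) ⊎ InA p ⊎ InC₀ p ⊎ InD₀ p
S₁ p = (EvenOdd p × ¬ InA p) ⊎ InB p ⊎ InC₁ p ⊎ InD₁ p
S₂ p = OddOdd p × ¬ InC p
S₃ p = OddEven p × ¬ InD p

module Submission where

open import Defs
open import Data.Bool using (Bool; true; false; not; _xor_; if_then_else_)
open import Data.Bool.Properties using (not-involutive; not-injective; not-distribˡ-xor; xor-same)
open import Data.Empty using (⊥; ⊥-elim)
open import Data.List using (List; []; _∷_)
open import Data.Nat using (ℕ; zero; suc; _+_; _*_; _∸_; _≤_; _<_; _≟_; z≤n; s≤s)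
open import Data.Nat.DivMod using (_%_)
open import Data.Nat.Properties using (+-identityʳ; +-suc; +-cancelˡ-≡; *-distribˡ-+; *-cancelˡ-<; *-cancelˡ-≤; suc-injective; ≤-pred; ≤-trans; m≤m+n; m≤n⇒m≤o+n; m≤n⇒∃[o]m+o≡n; 0≢1+n; 1+n≢0)
open import Data.Nat.Tactic.RingSolver using (solve-∀; solve)
open import Data.Product using (_×_; _,_; ∃-syntax)
open import Data.Sum using (inj₁; inj₂)
open import Function.Bundles using (_⇔_; mk⇔)
open import Relation.Nullary using (¬_; does)
open import Relation.Binary.PropositionalEquality using (_≡_; refl; sym; trans; cong; cong₂; subst; subst₂; module ≡-Reasoning)

-- Write a sorted position as (x, x + p, x + p + q).  The proof has two parts.
--
-- 1. A closed form.  grundy x b q depends on the smallest pile x, the parity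
--    b of the middle gap p and the last gap q, and sg-sorted shows
--    sg x (x + p) (x + p + q) ≡ grundy x (odd p) q.  As sg is symmetric in the
--    piles, every option is again a sorted position, so it suffices that the
--    closed form obeys the mex recursion; this is a finite check because the
--    closed form is invariant under (x, q) ↦ (x + 2, q + 2) and its rows q ≤ 1
--    are 4-periodic in x.
--
-- A pair (x, q) is either regular, where the value
--    only depends on the parities of x and p (the base sets {(2a,2b,c)}, …),
--    or narrow, i.e. of the shape of the exceptional sets A, B (x even) or
--    C_r, D_r (x odd), where the parity of a + i decides the value (kind,
--    narrowAB-value, narrowCD-value).  Membership in A, B, C_r, D_r is exactly
--    narrowness together with the parity of the middle pile (A-narrow,
--    narrow→A, …).

odd : ℕ → Bool
odd zero    = false
odd (suc n) = not (odd n)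

bit : Bool → ℕ
bit false = 0
bit true  = 1

odd-bit : ∀ b → odd (bit b) ≡ b
odd-bit false = refl
odd-bit true  = refl

odd-+ : ∀ m n → odd (m + n) ≡ odd m xor odd n
odd-+ zero    n = refl
odd-+ (suc m) n = trans (cong not (odd-+ m n)) (not-distribˡ-xor (odd m) (odd n))

odd-2+ : ∀ n → odd (2 + n) ≡ odd n
odd-2+ n = not-involutive (odd n)

odd-double : ∀ n → odd (2 * n) ≡ false
odd-double n = begin
  odd (n + (n + 0))      ≡⟨ odd-+ n (n + 0) ⟩
  odd n xor odd (n + 0)  ≡⟨ cong (λ m → odd n xor odd m) (+-identityʳ n) ⟩
  odd n xor odd n        ≡⟨ xor-same (odd n) ⟩
  false                  ∎
  where open ≡-Reasoning

odd-double+1 : ∀ n → odd (2 * n + 1) ≡ true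
odd-double+1 n = trans (odd-+ (2 * n) 1) (cong (_xor true) (odd-double n))

odd-pred-double : ∀ {n a} → suc n ≡ 2 * a → odd n ≡ true
odd-pred-double {a = a} e = not-injective (trans (cong odd e) (odd-double a))

parity-clash : ∀ {b} → b ≡ true → b ≡ false → ⊥
parity-clash refl ()

odd-gap : ∀ x p {bx by} → odd x ≡ bx → odd (x + p) ≡ by → odd p ≡ bx xor by
odd-gap x p refl refl = trans (cancel (odd x) (odd p)) (cong (odd x xor_) (sym (odd-+ x p)))
  where
  cancel : ∀ c d → d ≡ c xor (c xor d)
  cancel false d = refl
  cancel true  d = sym (not-involutive d)

odd-excess : ∀ i m → odd (i + m + i) ≡ odd m
odd-excess i m = begin
  odd (i + m + i)          ≡⟨ cong odd rearrange ⟩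
  odd (2 * i + m)          ≡⟨ odd-+ (2 * i) m ⟩
  odd (2 * i) xor odd m    ≡⟨ cong (_xor odd m) (odd-double i) ⟩
  odd m                    ∎
  where
  open ≡-Reasoning
  rearrange : i + m + i ≡ 2 * i + m
  rearrange = solve (i ∷ m ∷ [])

even⇒double : ∀ n → odd n ≡ false → ∃[ k ] n ≡ 2 * k
odd⇒double+1 : ∀ n → odd n ≡ true → ∃[ k ] n ≡ 2 * k + 1

even⇒double zero    _ = 0 , refl
even⇒double (suc n) e with odd⇒double+1 n (not-injective e)
... | k , refl = suc k , solve (k ∷ [])

odd⇒double+1 (suc n) e with even⇒double n (not-injective e)
... | k , refl = k , solve (k ∷ [])

%2≡bit-odd : ∀ n → n % 2 ≡ bit (odd n)
%2≡bit-odd 0             = refl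
%2≡bit-odd 1             = refl
%2≡bit-odd (suc (suc n)) = trans (%2≡bit-odd n) (cong bit (sym (odd-2+ n)))

%2⇒odd : ∀ n {r} → n % 2 ≡ r → odd n ≡ odd r
%2⇒odd n refl = sym (trans (cong odd (%2≡bit-odd n)) (odd-bit (odd n)))

halve-≤ : ∀ {a b} → 2 * a ≤ 2 * b + 1 → a ≤ b
halve-≤ {a} {b} h = ≤-pred (*-cancelˡ-< 2 a (suc b) (subst (2 * a <_) double-suc (s≤s h)))
  where
  double-suc : suc (2 * b + 1) ≡ 2 * suc b
  double-suc = solve (b ∷ [])

mexFrom-cong : ∀ {l l′} → (∀ n → elem n l ≡ elem n l′) → ∀ f n → mexFrom l f n ≡ mexFrom l′ f n
mexFrom-cong same zero    n = refl
mexFrom-cong same (suc f) n =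
  cong₂ (λ b m → if b then m else n) (same n) (mexFrom-cong same f (suc n))

elem-swap : ∀ n u v l → elem n (u ∷ v ∷ l) ≡ elem n (v ∷ u ∷ l)
elem-swap n u v l with does (n ≟ u) | does (n ≟ v)
... | true  | true  = refl
... | true  | false = refl
... | false | true  = refl
... | false | false = refl

mex-swap₁₂ : ∀ u v w → mex (u ∷ v ∷ w ∷ []) ≡ mex (v ∷ u ∷ w ∷ [])
mex-swap₁₂ u v w = mexFrom-cong {u ∷ v ∷ w ∷ []} {v ∷ u ∷ w ∷ []} (λ n → elem-swap n u v (w ∷ [])) 3 0

mex-swap₂₃ : ∀ u v w → mex (u ∷ v ∷ w ∷ []) ≡ mex (u ∷ w ∷ v ∷ [])
mex-swap₂₃ u v w =
  mexFrom-cong {u ∷ v ∷ w ∷ []} {u ∷ w ∷ v ∷ []}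
    (λ n → cong (λ b → if does (n ≟ u) then true else b) (elem-swap n v w [])) 3 0

mex-cong₃ : ∀ {u v w u′ v′ w′} → u ≡ u′ → v ≡ v′ → w ≡ w′ →
  mex (u ∷ v ∷ w ∷ []) ≡ mex (u′ ∷ v′ ∷ w′ ∷ [])
mex-cong₃ refl refl refl = refl

mex-cong₁ : ∀ {u u′} → u ≡ u′ → mex (u ∷ []) ≡ mex (u′ ∷ [])
mex-cong₁ refl = refl

sg-swap₂₃ : ∀ a b c → sg a b c ≡ sg a c b
sg-swap₂₃ zero    zero    zero    = refl
sg-swap₂₃ zero    zero    (suc c) = refl
sg-swap₂₃ zero    (suc b) zero    = refl
sg-swap₂₃ zero    (suc b) (suc c) = mex-cong₁ (sg-swap₂₃ zero b c)
sg-swap₂₃ (suc a) zero    zero    = refl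
sg-swap₂₃ (suc a) (suc b) zero    = mex-cong₁ (sg-swap₂₃ a b zero)
sg-swap₂₃ (suc a) zero    (suc c) = mex-cong₁ (sg-swap₂₃ a zero c)
sg-swap₂₃ (suc a) (suc b) (suc c) =
  trans (mex-cong₃ (sg-swap₂₃ a b (suc c)) (sg-swap₂₃ a (suc b) c) (sg-swap₂₃ (suc a) b c))
        (mex-swap₁₂ (sg a (suc c) b) (sg a c (suc b)) (sg (suc a) c b))

sg-swap₁₂ : ∀ a b c → sg a b c ≡ sg b a c
sg-swap₁₂ zero    zero    c       = refl
sg-swap₁₂ zero    (suc b) zero    = refl
sg-swap₁₂ zero    (suc b) (suc c) = mex-cong₁ (sg-swap₁₂ zero b c)
sg-swap₁₂ (suc a) zero    zero    = refl
sg-swap₁₂ (suc a) zero    (suc c) = mex-cong₁ (sg-swap₁₂ a zero c)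
sg-swap₁₂ (suc a) (suc b) zero    = mex-cong₁ (sg-swap₁₂ a b zero)
sg-swap₁₂ (suc a) (suc b) (suc c) =
  trans (mex-cong₃ (sg-swap₁₂ a b (suc c)) (sg-swap₁₂ a (suc b) c) (sg-swap₁₂ (suc a) b c))
        (mex-swap₂₃ (sg b a (suc c)) (sg (suc b) a c) (sg b (suc a) c))

row₀ : ℕ → Bool → ℕ
row₀ 0 false = 0
row₀ 1 false = 1
row₀ 2 false = 0
row₀ 3 false = 0
row₀ 0 true  = 1
row₀ 1 true  = 0
row₀ 2 true  = 1
row₀ 3 true  = 1
row₀ (suc (suc (suc (suc x)))) b = row₀ x b

row₁ : ℕ → Bool → ℕ
row₁ 0 false = 0
row₁ 1 false = 2
row₁ 2 false = 1
row₁ 3 false = 2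
row₁ 0 true  = 1
row₁ 1 true  = 3
row₁ 2 true  = 0
row₁ 3 true  = 3
row₁ (suc (suc (suc (suc x)))) b = row₁ x b

-- grundy x b q is the Grundy value of (x, x + p, x + p + q) where b = odd p.
-- Subtracting 2 from x and q leaves it unchanged until one of them is ≤ 1.
grundy : ℕ → Bool → ℕ → ℕ
grundy x             b 0             = row₀ x b
grundy x             b 1             = row₁ x b
grundy 0             b (suc (suc q)) = bit b
grundy 1             b (suc (suc q)) = 2 + bit b
grundy (suc (suc x)) b (suc (suc q)) = grundy x b q

-- The closed-form values of the three options of (x, x, x + q), one per
-- pair of piles …
optionsEqual : ℕ → ℕ → List ℕ
optionsEqual zero    q       = []
optionsEqual (suc x) zero    = grundy x false 1 ∷ grundy x false 1 ∷ grundy x false 1 ∷ []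
optionsEqual (suc x) (suc q) = grundy x false (2 + q) ∷ grundy x true q ∷ grundy x true q ∷ []

-- … and of (x, x + 1 + p, x + 1 + p + q), where c = odd p (so not c and
-- not (not c) are the parities of the middle gaps p + 1 and p + 2).
optionsApart : ℕ → Bool → ℕ → List ℕ
optionsApart zero    c q       = grundy 0 c q ∷ []
optionsApart (suc x) c zero    =
  grundy x (not c) 1 ∷ grundy x (not c) 1 ∷ grundy (suc x) c 0 ∷ []
optionsApart (suc x) c (suc q) =
  grundy x (not c) (2 + q) ∷ grundy x (not (not c)) q ∷ grundy (suc x) c (suc q) ∷ []

-- Both sides are invariant
-- under adding 2 to x and q when x, q ≥ 1, and 4-periodic in x for q ≤ 2,
-- so finitely many cases are checked by evaluation.
mex-optionsEqual : ∀ x q → mex (optionsEqual x q) ≡ grundy x false q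
mex-optionsEqual 0 0 = refl
mex-optionsEqual 0 1 = refl
mex-optionsEqual 0 (suc (suc q)) = refl
mex-optionsEqual 1 0 = refl
mex-optionsEqual 1 1 = refl
mex-optionsEqual 1 2 = refl
mex-optionsEqual 1 (suc (suc (suc q))) = refl
mex-optionsEqual 2 0 = refl
mex-optionsEqual 2 1 = refl
mex-optionsEqual 2 2 = refl
mex-optionsEqual 2 3 = refl
mex-optionsEqual 2 (suc (suc (suc (suc q)))) = refl
mex-optionsEqual (suc (suc (suc x))) (suc (suc (suc q))) = mex-optionsEqual (suc x) (suc q)
mex-optionsEqual 3 0 = refl
mex-optionsEqual 3 1 = refl
mex-optionsEqual 3 2 = refl
mex-optionsEqual 4 0 = refl
mex-optionsEqual 4 1 = refl
mex-optionsEqual 4 2 = refl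
mex-optionsEqual 5 0 = refl
mex-optionsEqual 5 1 = refl
mex-optionsEqual 5 2 = refl
mex-optionsEqual 6 0 = refl
mex-optionsEqual 6 1 = refl
mex-optionsEqual 6 2 = refl
mex-optionsEqual (suc (suc (suc (suc (suc (suc (suc x))))))) 0 = mex-optionsEqual (suc (suc (suc x))) 0
mex-optionsEqual (suc (suc (suc (suc (suc (suc (suc x))))))) 1 = mex-optionsEqual (suc (suc (suc x))) 1
mex-optionsEqual (suc (suc (suc (suc (suc (suc (suc x))))))) 2 = mex-optionsEqual (suc (suc (suc x))) 2

mex-optionsApart : ∀ x c q → mex (optionsApart x c q) ≡ grundy x (not c) q
mex-optionsApart 0 true  0 = refl
mex-optionsApart 0 false 0 = refl
mex-optionsApart 0 true  1 = refl
mex-optionsApart 0 false 1 = refl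
mex-optionsApart 0 true  (suc (suc q)) = refl
mex-optionsApart 0 false (suc (suc q)) = refl
mex-optionsApart 1 true  0 = refl
mex-optionsApart 1 false 0 = refl
mex-optionsApart 1 true  1 = refl
mex-optionsApart 1 false 1 = refl
mex-optionsApart 1 true  2 = refl
mex-optionsApart 1 false 2 = refl
mex-optionsApart 1 true  (suc (suc (suc q))) = refl
mex-optionsApart 1 false (suc (suc (suc q))) = refl
mex-optionsApart 2 true  0 = refl
mex-optionsApart 2 false 0 = refl
mex-optionsApart 2 true  1 = refl
mex-optionsApart 2 false 1 = refl
mex-optionsApart 2 true  2 = refl
mex-optionsApart 2 false 2 = refl
mex-optionsApart 2 true  3 = refl
mex-optionsApart 2 false 3 = refl
mex-optionsApart 2 true  (suc (suc (suc (suc q)))) = refl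
mex-optionsApart 2 false (suc (suc (suc (suc q)))) = refl
mex-optionsApart (suc (suc (suc x))) c (suc (suc (suc q))) = mex-optionsApart (suc x) c (suc q)
mex-optionsApart 3 true  0 = refl
mex-optionsApart 3 false 0 = refl
mex-optionsApart 3 true  1 = refl
mex-optionsApart 3 false 1 = refl
mex-optionsApart 3 true  2 = refl
mex-optionsApart 3 false 2 = refl
mex-optionsApart 4 true  0 = refl
mex-optionsApart 4 false 0 = refl
mex-optionsApart 4 true  1 = refl
mex-optionsApart 4 false 1 = refl
mex-optionsApart 4 true  2 = refl
mex-optionsApart 4 false 2 = refl
mex-optionsApart 5 true  0 = refl
mex-optionsApart 5 false 0 = refl
mex-optionsApart 5 true  1 = refl
mex-optionsApart 5 false 1 = refl
mex-optionsApart 5 true  2 = refl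
mex-optionsApart 5 false 2 = refl
mex-optionsApart 6 true  0 = refl
mex-optionsApart 6 false 0 = refl
mex-optionsApart 6 true  1 = refl
mex-optionsApart 6 false 1 = refl
mex-optionsApart 6 true  2 = refl
mex-optionsApart 6 false 2 = refl
mex-optionsApart (suc (suc (suc (suc (suc (suc (suc x))))))) c 0 = mex-optionsApart (suc (suc (suc x))) c 0
mex-optionsApart (suc (suc (suc (suc (suc (suc (suc x))))))) c 1 = mex-optionsApart (suc (suc (suc x))) c 1
mex-optionsApart (suc (suc (suc (suc (suc (suc (suc x))))))) c 2 = mex-optionsApart (suc (suc (suc x))) c 2

-- Induction on (x, p):
-- each option, once sorted, is a smaller sorted position.
sg-sorted : ∀ x p q {w y z} → w ≡ x → y ≡ x + p → z ≡ y + q → sg w y z ≡ grundy x (odd p) q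
sg-sorted zero zero    q refl refl refl = mex-optionsEqual 0 q
sg-sorted zero (suc p) q refl refl refl =
  trans (mex-cong₁ (sg-sorted 0 p q refl refl refl)) (mex-optionsApart 0 (odd p) q)
sg-sorted (suc x) zero zero refl refl refl =
  trans (mex-cong₃ move₁₂ move₁₃ move₂₃) (mex-optionsEqual (suc x) 0)
  where
  move₁₂ : sg x (x + 0) (suc (x + 0 + 0)) ≡ grundy x false 1
  move₁₂ = sg-sorted x 0 1 refl refl (solve (x ∷ []))
  move₁₃ : sg x (suc (x + 0)) (x + 0 + 0) ≡ grundy x false 1
  move₁₃ = trans (sg-swap₂₃ x (suc (x + 0)) (x + 0 + 0))
                 (sg-sorted x 0 1 refl (solve (x ∷ [])) (solve (x ∷ [])))
  move₂₃ : sg (suc x) (x + 0) (x + 0 + 0) ≡ grundy x false 1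
  move₂₃ = trans (sg-swap₁₂ (suc x) (x + 0) (x + 0 + 0))
           (trans (sg-swap₂₃ (x + 0) (suc x) (x + 0 + 0))
                  (sg-sorted x 0 1 {x + 0} {x + 0 + 0} {suc x}
                     (solve (x ∷ [])) (solve (x ∷ [])) (solve (x ∷ []))))
sg-sorted (suc x) zero (suc q) refl refl refl =
  trans (mex-cong₃ move₁₂ move₁₃ move₂₃) (mex-optionsEqual (suc x) (suc q))
  where
  move₁₂ : sg x (x + 0) (suc (x + 0 + suc q)) ≡ grundy x false (2 + q)
  move₁₂ = sg-sorted x 0 (2 + q) refl refl (solve (x ∷ q ∷ []))
  move₁₃ : sg x (suc (x + 0)) (x + 0 + suc q) ≡ grundy x true q
  move₁₃ = sg-sorted x 1 q refl (solve (x ∷ [])) (solve (x ∷ q ∷ []))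
  move₂₃ : sg (suc x) (x + 0) (x + 0 + suc q) ≡ grundy x true q
  move₂₃ = trans (sg-swap₁₂ (suc x) (x + 0) (x + 0 + suc q))
                 (sg-sorted x 1 q {x + 0} {suc x} {x + 0 + suc q}
                    (solve (x ∷ [])) (solve (x ∷ [])) (solve (x ∷ q ∷ [])))
sg-sorted (suc x) (suc p) zero refl refl refl =
  trans (mex-cong₃ move₁₂ move₁₃ (sg-sorted (suc x) p 0 {suc x} {x + suc p} refl (+-suc x p) refl))
        (mex-optionsApart (suc x) (odd p) 0)
  where
  move₁₂ : sg x (x + suc p) (suc (x + suc p + 0)) ≡ grundy x (odd (suc p)) 1
  move₁₂ = sg-sorted x (suc p) 1 refl refl (solve (x ∷ p ∷ []))
  move₁₃ : sg x (suc (x + suc p)) (x + suc p + 0) ≡ grundy x (odd (suc p)) 1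
  move₁₃ = trans (sg-swap₂₃ x (suc (x + suc p)) (x + suc p + 0))
                 (sg-sorted x (suc p) 1 refl (solve (x ∷ p ∷ [])) (solve (x ∷ p ∷ [])))
sg-sorted (suc x) (suc p) (suc q) refl refl refl =
  trans (mex-cong₃ move₁₂ move₁₃ (sg-sorted (suc x) p (suc q) {suc x} {x + suc p} refl (+-suc x p) refl))
        (mex-optionsApart (suc x) (odd p) (suc q))
  where
  move₁₂ : sg x (x + suc p) (suc (x + suc p + suc q)) ≡ grundy x (odd (suc p)) (2 + q)
  move₁₂ = sg-sorted x (suc p) (2 + q) refl refl (solve (x ∷ p ∷ q ∷ []))
  move₁₃ : sg x (suc (x + suc p)) (x + suc p + suc q) ≡ grundy x (odd (suc (suc p))) q
  move₁₃ = sg-sorted x (suc (suc p)) q refl (solve (x ∷ p ∷ [])) (solve (x ∷ p ∷ q ∷ []))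

grundy-shift : ∀ k u b v → grundy (2 * k + u) b (2 * k + v) ≡ grundy u b v
grundy-shift zero    u b v = refl
grundy-shift (suc k) u b v =
  trans (cong₂ (λ x q → grundy x b q) (double-suc+ u) (double-suc+ v)) (grundy-shift k u b v)
  where
  double-suc+ : ∀ w → 2 * suc k + w ≡ 2 + (2 * k + w)
  double-suc+ w = solve (k ∷ w ∷ [])

row₁-double : ∀ m b → row₁ (2 * m) b ≡ bit (odd m xor b)
row₁-double 0 false = refl
row₁-double 0 true  = refl
row₁-double 1 false = refl
row₁-double 1 true  = refl
row₁-double (suc (suc m)) b = begin
  row₁ (2 * (2 + m)) b        ≡⟨ cong (λ n → row₁ n b) unfold ⟩
  row₁ (4 + 2 * m) b          ≡⟨ row₁-double m b ⟩
  bit (odd m xor b)           ≡⟨ cong (λ c → bit (c xor b)) (sym (odd-2+ m)) ⟩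
  bit (odd (2 + m) xor b)     ∎
  where
  open ≡-Reasoning
  unfold : 2 * (2 + m) ≡ 4 + 2 * m
  unfold = solve (m ∷ [])

row₀-double+1 : ∀ m b → row₀ (2 * m + 1) b ≡ bit (not (odd m) xor b)
row₀-double+1 0 false = refl
row₀-double+1 0 true  = refl
row₀-double+1 1 false = refl
row₀-double+1 1 true  = refl
row₀-double+1 (suc (suc m)) b = begin
  row₀ (2 * (2 + m) + 1) b          ≡⟨ cong (λ n → row₀ n b) unfold ⟩
  row₀ (4 + (2 * m + 1)) b          ≡⟨ row₀-double+1 m b ⟩
  bit (not (odd m) xor b)           ≡⟨ cong (λ c → bit (not c xor b)) (sym (odd-2+ m)) ⟩
  bit (not (odd (2 + m)) xor b)     ∎
  where
  open ≡-Reasoning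
  unfold : 2 * (2 + m) + 1 ≡ 4 + (2 * m + 1)
  unfold = solve (m ∷ [])

-- (x, q) is narrow of type AB when x = 2a and q = 2i + 1 with i < a and
-- a + i odd (the shape of the sets A and B) …
data NarrowAB (x q : ℕ) : Set where
  ab : ∀ a i → i < a → (a + i) % 2 ≡ 1 → x ≡ 2 * a → q ≡ 2 * i + 1 → NarrowAB x q

-- … and narrow of type CD with residue r when x = 2a - 1 and q = 2i with
-- i < a and a + i ≡ r (mod 2) (the shape of the sets C_r and D_r).
data NarrowCD (r x q : ℕ) : Set where
  cd : ∀ a i → i < a → (a + i) % 2 ≡ r → suc x ≡ 2 * a → q ≡ 2 * i → NarrowCD r x q

excess : ∀ {i a} → i < a → ∃[ e ] a ≡ i + suc e
excess {i} i<a with m≤n⇒∃[o]m+o≡n i<a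
... | e , refl = e , sym (+-suc i e)

-- On AB-narrow pairs the value is that of the base value for the other
-- parity of the middle gap: row 1 is flipped where x - q ≡ 1 (mod 4).
narrowAB-value : ∀ {x q} → NarrowAB x q → ∀ b → grundy x b q ≡ bit (not b)
narrowAB-value (ab a i i<a a+i-odd refl refl) b with excess i<a
... | e , refl = begin
  grundy (2 * (i + suc e)) b (2 * i + 1)     ≡⟨ cong (λ x → grundy x b (2 * i + 1)) (*-distribˡ-+ 2 i (suc e)) ⟩
  grundy (2 * i + 2 * suc e) b (2 * i + 1)   ≡⟨ grundy-shift i (2 * suc e) b 1 ⟩
  row₁ (2 * suc e) b                         ≡⟨ row₁-double (suc e) b ⟩
  bit (odd (suc e) xor b)                    ≡⟨ cong (λ c → bit (c xor b)) excess-odd ⟩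
  bit (not b)                                ∎
  where
  open ≡-Reasoning
  excess-odd : odd (suc e) ≡ true
  excess-odd = trans (sym (odd-excess i (suc e))) (%2⇒odd (i + suc e + i) a+i-odd)

-- On CD-narrow pairs row 0 decides: the value is flipped iff r = 1,
-- i.e. iff x - q ≡ 1 (mod 4).
narrowCD-value : ∀ {r x q} → NarrowCD r x q → ∀ b → grundy x b q ≡ bit (odd r xor b)
narrowCD-value {r} {x} (cd a i i<a a+i≡r x+1≡2a refl) b with excess i<a
... | e , refl = begin
  grundy x b (2 * i)                           ≡⟨ cong₂ (λ x q → grundy x b q) x-split (sym (+-identityʳ (2 * i))) ⟩
  grundy (2 * i + (2 * e + 1)) b (2 * i + 0)   ≡⟨ grundy-shift i (2 * e + 1) b 0 ⟩
  row₀ (2 * e + 1) b                           ≡⟨ row₀-double+1 e b ⟩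
  bit (odd (suc e) xor b)                      ≡⟨ cong (λ c → bit (c xor b)) excess-parity ⟩
  bit (odd r xor b)                            ∎
  where
  open ≡-Reasoning
  rearrange : 2 * (i + suc e) ≡ suc (2 * i + (2 * e + 1))
  rearrange = solve (i ∷ e ∷ [])
  x-split : x ≡ 2 * i + (2 * e + 1)
  x-split = suc-injective (trans x+1≡2a rearrange)
  excess-parity : odd (suc e) ≡ odd r
  excess-parity = trans (sym (odd-excess i (suc e))) (%2⇒odd (i + suc e + i) a+i≡r)

narrowAB-even : ∀ {x q} → NarrowAB x q → odd x ≡ false
narrowAB-even (ab a _ _ _ refl _) = odd-double a

narrowCD-odd : ∀ {r x q} → NarrowCD r x q → odd x ≡ true
narrowCD-odd (cd a _ _ _ x+1≡2a _) = odd-pred-double {a = a} x+1≡2a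

-- Off the narrow pairs the value only depends on the parities of x and of
-- the middle gap: 0/1 for even x and 2/3 for odd x.
baseValue : Bool → Bool → ℕ
baseValue false b = bit b
baseValue true  b = 2 + bit b

Regular : ℕ → ℕ → Set
Regular x q = ∀ b → grundy x b q ≡ baseValue (odd x) b

data Kind (x q : ℕ) : Set where
  narrowAB  : NarrowAB x q   → Kind x q
  narrowCD₀ : NarrowCD 0 x q → Kind x q
  narrowCD₁ : NarrowCD 1 x q → Kind x q
  regular   : Regular x q    → Kind x q

shift-%2 : ∀ a i → (suc a + suc i) % 2 ≡ (a + i) % 2
shift-%2 a i = cong (λ n → suc n % 2) (+-suc a i)

shift-double : ∀ {x} a → suc x ≡ 2 * a → suc (2 + x) ≡ 2 * suc a
shift-double a x+1≡2a = trans (cong (2 +_) x+1≡2a) (solve (a ∷ []))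

kind-shift : ∀ {x q} → Kind x q → Kind (2 + x) (2 + q)
kind-shift (narrowAB (ab a i i<a a+i-odd refl refl)) =
  narrowAB (ab (suc a) (suc i) (s≤s i<a) (trans (shift-%2 a i) a+i-odd)
               (solve (a ∷ [])) (solve (i ∷ [])))
kind-shift (narrowCD₀ (cd a i i<a a+i≡0 x+1≡2a refl)) =
  narrowCD₀ (cd (suc a) (suc i) (s≤s i<a) (trans (shift-%2 a i) a+i≡0)
                (shift-double a x+1≡2a) (solve (i ∷ [])))
kind-shift (narrowCD₁ (cd a i i<a a+i≡1 x+1≡2a refl)) =
  narrowCD₁ (cd (suc a) (suc i) (s≤s i<a) (trans (shift-%2 a i) a+i≡1)
                (shift-double a x+1≡2a) (solve (i ∷ [])))
kind-shift {x} (regular reg) = regular (λ b → trans (reg b) (cong (λ c → baseValue c b) (sym (odd-2+ x))))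

kind-period : ∀ {x q} → (∀ b → grundy (4 + x) b q ≡ grundy x b q) → Kind x q → Kind (4 + x) q
kind-period _ (narrowAB (ab a i i<a a+i-odd refl q≡)) =
  narrowAB (ab (2 + a) i (m≤n⇒m≤o+n 2 i<a) a+i-odd (solve (a ∷ [])) q≡)
kind-period _ (narrowCD₀ (cd a i i<a a+i≡0 x+1≡2a q≡)) =
  narrowCD₀ (cd (2 + a) i (m≤n⇒m≤o+n 2 i<a) a+i≡0 (shift-double (suc a) (shift-double a x+1≡2a)) q≡)
kind-period _ (narrowCD₁ (cd a i i<a a+i≡1 x+1≡2a q≡)) =
  narrowCD₁ (cd (2 + a) i (m≤n⇒m≤o+n 2 i<a) a+i≡1 (shift-double (suc a) (shift-double a x+1≡2a)) q≡)
kind-period {x} periodic (regular reg) = regular (λ b →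
  trans (periodic b) (trans (reg b) (cong (λ c → baseValue c b) (sym (trans (odd-2+ (2 + x)) (odd-2+ x))))))

-- The kind of every pair: rows q = 0, 1 by 4-periodicity, the rest by shifting.
kind : ∀ x q → Kind x q
kind 0 0             = regular λ { false → refl ; true → refl }
kind 0 1             = regular λ { false → refl ; true → refl }
kind 0 (suc (suc q)) = regular λ _ → refl
kind 1 0             = narrowCD₁ (cd 1 0 (s≤s z≤n) refl refl refl)
kind 1 1             = regular λ { false → refl ; true → refl }
kind 1 (suc (suc q)) = regular λ _ → refl
kind 2 0             = regular λ { false → refl ; true → refl }
kind 3 0             = narrowCD₀ (cd 2 0 (s≤s z≤n) refl refl refl)
kind 4 0             = regular λ { false → refl ; true → refl }
kind 5 0             = narrowCD₁ (cd 3 0 (s≤s z≤n) refl refl refl)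
kind (suc (suc (suc (suc (suc (suc x)))))) 0 = kind-period (λ _ → refl) (kind (suc (suc x)) 0)
kind 2 1             = narrowAB (ab 1 0 (s≤s z≤n) refl refl refl)
kind 3 1             = regular λ { false → refl ; true → refl }
kind 4 1             = regular λ { false → refl ; true → refl }
kind 5 1             = regular λ { false → refl ; true → refl }
kind (suc (suc (suc (suc (suc (suc x)))))) 1 = kind-period (λ _ → refl) (kind (suc (suc x)) 1)
kind (suc (suc x)) (suc (suc q)) = kind-shift (kind x q)

position : ℕ → ℕ → ℕ → Pos
position x p q = x , x + p , x + p + q

last-gap : ∀ {y q Y Q} → y ≡ Y → y + q ≡ Y + Q → q ≡ Q
last-gap {q = q} {Y} {Q} refl = +-cancelˡ-≡ Y q Q

double∸1 : ∀ n → 2 * suc n ∸ 1 ≡ 2 * n + 1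
double∸1 n = unfolded n
  where
  unfolded : ∀ n → n + suc (n + 0) ≡ 2 * n + 1
  unfolded = solve-∀

suc-double∸1 : ∀ {a n} → 0 < a → n ≡ 2 * a ∸ 1 → suc n ≡ 2 * a
suc-double∸1 (s≤s _) refl = refl

A-narrow : ∀ {x p q} → InA (position x p q) → NarrowAB x q × odd (x + p) ≡ true
A-narrow {p = p} {q} (a , suc b , i , s≤s _ , i<a , a+i-odd , refl , y≡ , z≡) =
  ab a i i<a a+i-odd refl (last-gap y-odd (trans z≡ z-split)) ,
  trans (cong odd y-odd) (odd-double+1 b)
  where
  y-odd : 2 * a + p ≡ 2 * b + 1
  y-odd = trans y≡ (double∸1 b)
  z-split : 2 * (suc b + i) ≡ 2 * b + 1 + (2 * i + 1)
  z-split = solve (b ∷ i ∷ [])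

B-narrow : ∀ {x p q} → InB (position x p q) → NarrowAB x q × odd (x + p) ≡ false
B-narrow (a , b , i , _ , i<a , a+i-odd , refl , y≡ , z≡) =
  ab a i i<a a+i-odd refl (last-gap y≡ (trans z≡ z-split)) , trans (cong odd y≡) (odd-double b)
  where
  z-split : 2 * (b + i) + 1 ≡ 2 * b + (2 * i + 1)
  z-split = solve (b ∷ i ∷ [])

C-narrow : ∀ {r x p q} → InCr r (position x p q) → NarrowCD r x q × odd (x + p) ≡ true
C-narrow {x = x} {p} {q} (a , b , i , a≤b , i<a , a+i≡r , x≡ , y≡ , z≡) =
  cd a i i<a a+i≡r (suc-double∸1 0<a x≡) (last-gap y+1≡ z+1≡) , odd-pred-double {a = b} y+1≡
  where
  0<a : 0 < a
  0<a = ≤-trans (s≤s z≤n) i<a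
  0<b : 0 < b
  0<b = ≤-trans 0<a a≤b
  y+1≡ : suc (x + p) ≡ 2 * b
  y+1≡ = suc-double∸1 0<b y≡
  z+1≡ : suc (x + p) + q ≡ 2 * b + 2 * i
  z+1≡ = trans (suc-double∸1 (≤-trans 0<b (m≤m+n b i)) z≡) (*-distribˡ-+ 2 b i)

D-narrow : ∀ {r x p q} → InDr r (position x p q) → NarrowCD r x q × odd (x + p) ≡ false
D-narrow (a , b , i , _ , i<a , a+i≡r , x≡ , y≡ , z≡) =
  cd a i i<a a+i≡r (suc-double∸1 (≤-trans (s≤s z≤n) i<a) x≡)
     (last-gap y≡ (trans z≡ (*-distribˡ-+ 2 b i))) ,
  trans (cong odd y≡) (odd-double b)

narrow→A : ∀ {x p q} → NarrowAB x q → odd (x + p) ≡ true → InA (position x p q)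
narrow→A {p = p} (ab a i i<a a+i-odd refl refl) y-odd with odd⇒double+1 (2 * a + p) y-odd
... | b , y≡ =
  a , suc b , i , s≤s (halve-≤ a≤b) , i<a , a+i-odd , refl , trans y≡ (sym (double∸1 b)) , z≡
  where
  a≤b : 2 * a ≤ 2 * b + 1
  a≤b = subst (2 * a ≤_) y≡ (m≤m+n (2 * a) p)
  z≡ : 2 * a + p + (2 * i + 1) ≡ 2 * (suc b + i)
  z≡ = trans (cong (_+ (2 * i + 1)) y≡) (solve (b ∷ i ∷ []))

narrow→B : ∀ {x p q} → NarrowAB x q → odd (x + p) ≡ false → InB (position x p q)
narrow→B {p = p} (ab a i i<a a+i-odd refl refl) y-even with even⇒double (2 * a + p) y-even
... | b , y≡ =
  a , b , i , *-cancelˡ-≤ 2 (subst (2 * a ≤_) y≡ (m≤m+n (2 * a) p)) , i<a , a+i-odd , refl , y≡ , z≡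
  where
  z≡ : 2 * a + p + (2 * i + 1) ≡ 2 * (b + i) + 1
  z≡ = trans (cong (_+ (2 * i + 1)) y≡) (solve (b ∷ i ∷ []))

narrow→C : ∀ {r x p q} → NarrowCD r x q → odd (x + p) ≡ true → InCr r (position x p q)
narrow→C {x = x} {p} (cd a i i<a a+i≡r x+1≡2a refl) y-odd with odd⇒double+1 (x + p) y-odd
... | b , y≡ = a , suc b , i , *-cancelˡ-≤ 2 a≤b , i<a , a+i≡r , cong (_∸ 1) x+1≡2a ,
               trans y≡ (sym (double∸1 b)) , z≡
  where
  a≤b : 2 * a ≤ 2 * suc b
  a≤b = subst₂ _≤_ x+1≡2a (trans (cong suc y≡) (solve (b ∷ []))) (s≤s (m≤m+n x p))
  regroup : 2 * b + 1 + 2 * i ≡ 2 * (b + i) + 1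
  regroup = solve (b ∷ i ∷ [])
  z≡ : x + p + 2 * i ≡ 2 * (suc b + i) ∸ 1
  z≡ = trans (cong (_+ 2 * i) y≡) (trans regroup (sym (double∸1 (b + i))))

narrow→D : ∀ {r x p q} → NarrowCD r x q → odd (x + p) ≡ false → InDr r (position x p q)
narrow→D {x = x} {p} (cd a i i<a a+i≡r x+1≡2a refl) y-even with even⇒double (x + p) y-even
... | b , y≡ = a , b , i , halve-≤ a≤b , i<a , a+i≡r , cong (_∸ 1) x+1≡2a , y≡ , z≡
  where
  a≤b : 2 * a ≤ 2 * b + 1
  a≤b = subst₂ _≤_ x+1≡2a (trans (cong suc y≡) (solve (b ∷ []))) (s≤s (m≤m+n x p))
  z≡ : x + p + 2 * i ≡ 2 * (b + i)
  z≡ = trans (cong (_+ 2 * i) y≡) (sym (*-distribˡ-+ 2 b i))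

A-value : ∀ {x p q} → InA (position x p q) → grundy x (odd p) q ≡ 0
A-value {x} {p} w with A-narrow w
... | n , y-odd =
  trans (narrowAB-value n (odd p)) (cong (λ c → bit (not c)) (odd-gap x p (narrowAB-even n) y-odd))

B-value : ∀ {x p q} → InB (position x p q) → grundy x (odd p) q ≡ 1
B-value {x} {p} w with B-narrow w
... | n , y-even =
  trans (narrowAB-value n (odd p)) (cong (λ c → bit (not c)) (odd-gap x p (narrowAB-even n) y-even))

C-value : ∀ {r x p q} → InCr r (position x p q) → grundy x (odd p) q ≡ bit (odd r xor false)
C-value {r} {x} {p} w with C-narrow w
... | n , y-odd =
  trans (narrowCD-value n (odd p)) (cong (λ c → bit (odd r xor c)) (odd-gap x p (narrowCD-odd n) y-odd))

D-value : ∀ {r x p q} → InDr r (position x p q) → grundy x (odd p) q ≡ bit (odd r xor true)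
D-value {r} {x} {p} w with D-narrow w
... | n , y-even =
  trans (narrowCD-value n (odd p)) (cong (λ c → bit (odd r xor c)) (odd-gap x p (narrowCD-odd n) y-even))

bounds : ∀ {x p q X Y} → x ≡ X → x + p ≡ Y → X ≤ Y × Y ≤ x + p + q
bounds {x} {p} {q} refl refl = m≤m+n x p , m≤m+n (x + p) q

EE-intro : ∀ {x p q} → odd x ≡ false → odd (x + p) ≡ false → EvenEven (position x p q)
EE-intro {x} {p} ex ey with even⇒double x ex | even⇒double (x + p) ey
... | a , x≡ | b , y≡ = let x≤y , y≤z = bounds x≡ y≡ in a , b , _ , x≤y , y≤z , x≡ , y≡ , refl

EO-intro : ∀ {x p q} → odd x ≡ false → odd (x + p) ≡ true → EvenOdd (position x p q)
EO-intro {x} {p} ex ey with even⇒double x ex | odd⇒double+1 (x + p) ey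
... | a , x≡ | b , y≡ = let x≤y , y≤z = bounds x≡ y≡ in a , b , _ , x≤y , y≤z , x≡ , y≡ , refl

OO-intro : ∀ {x p q} → odd x ≡ true → odd (x + p) ≡ true → OddOdd (position x p q)
OO-intro {x} {p} ex ey with odd⇒double+1 x ex | odd⇒double+1 (x + p) ey
... | a , x≡ | b , y≡ = let x≤y , y≤z = bounds x≡ y≡ in a , b , _ , x≤y , y≤z , x≡ , y≡ , refl

OE-intro : ∀ {x p q} → odd x ≡ true → odd (x + p) ≡ false → OddEven (position x p q)
OE-intro {x} {p} ex ey with odd⇒double+1 x ex | even⇒double (x + p) ey
... | a , x≡ | b , y≡ = let x≤y , y≤z = bounds x≡ y≡ in a , b , _ , x≤y , y≤z , x≡ , y≡ , refl

EE-parity : ∀ {x y z} → EvenEven (x , y , z) → odd x ≡ false × odd y ≡ false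
EE-parity (a , b , _ , _ , _ , refl , refl , _) = odd-double a , odd-double b

EO-parity : ∀ {x y z} → EvenOdd (x , y , z) → odd x ≡ false × odd y ≡ true
EO-parity (a , b , _ , _ , _ , refl , refl , _) = odd-double a , odd-double+1 b

OO-parity : ∀ {x y z} → OddOdd (x , y , z) → odd x ≡ true × odd y ≡ true
OO-parity (a , b , _ , _ , _ , refl , refl , _) = odd-double+1 a , odd-double+1 b

OE-parity : ∀ {x y z} → OddEven (x , y , z) → odd x ≡ true × odd y ≡ false
OE-parity (a , b , _ , _ , _ , refl , refl , _) = odd-double+1 a , odd-double b

regular-value : ∀ x p q {bx by} → Regular x q → odd x ≡ bx → odd (x + p) ≡ by →
  grundy x (odd p) q ≡ baseValue bx (bx xor by)
regular-value x p q reg ex ey = trans (reg (odd p)) (cong₂ baseValue ex (odd-gap x p ex ey))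

S : ℕ → Pred
S 0 = S₀
S 1 = S₁
S 2 = S₂
S 3 = S₃
S (suc (suc (suc (suc _)))) = λ _ → ⊥

S-bounded : ∀ n {t} → S n t → n ≤ 3
S-bounded 0 _ = z≤n
S-bounded 1 _ = s≤s z≤n
S-bounded 2 _ = s≤s (s≤s z≤n)
S-bounded 3 _ = s≤s (s≤s (s≤s z≤n))

S-at : ∀ {m n t} → m ≡ n → S n t → S m t
S-at {t = t} m≡n = subst (λ k → S k t) (sym m≡n)

-- A regular position in a parity class lies in that class's base set: it
-- cannot be exceptional, since there the value would differ.
base₀ : ∀ x p q → odd x ≡ false → odd (x + p) ≡ false → grundy x (odd p) q ≡ 0 → S₀ (position x p q)
base₀ x p q ex ey v = inj₁ (EE-intro ex ey , λ w → 0≢1+n (trans (sym v) (B-value w)))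

base₁ : ∀ x p q → odd x ≡ false → odd (x + p) ≡ true → grundy x (odd p) q ≡ 1 → S₁ (position x p q)
base₁ x p q ex ey v = inj₁ (EO-intro ex ey , λ w → 1+n≢0 (trans (sym v) (A-value w)))

base₂ : ∀ x p q → odd x ≡ true → odd (x + p) ≡ true → grundy x (odd p) q ≡ 2 → S₂ (position x p q)
base₂ x p q ex ey v = OO-intro ex ey , λ where
  (inj₁ w) → 1+n≢0 (trans (sym v) (C-value w))
  (inj₂ w) → 1+n≢0 (suc-injective (trans (sym v) (C-value w)))

base₃ : ∀ x p q → odd x ≡ true → odd (x + p) ≡ false → grundy x (odd p) q ≡ 3 → S₃ (position x p q)
base₃ x p q ex ey v = OE-intro ex ey , λ where
  (inj₁ w) → 1+n≢0 (trans (sym v) (D-value w))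
  (inj₂ w) → 1+n≢0 (suc-injective (trans (sym v) (D-value w)))

grundy-in-S : ∀ x p q → S (grundy x (odd p) q) (position x p q)
grundy-in-S x p q = place (kind x q) (odd x) (odd (x + p)) refl refl
  where
  place : Kind x q → ∀ bx by → odd x ≡ bx → odd (x + p) ≡ by → S (grundy x (odd p) q) (position x p q)
  place (narrowAB n)  _ true  _ ey = let w = narrow→A n ey in S-at (A-value w) (inj₂ (inj₁ w))
  place (narrowAB n)  _ false _ ey = let w = narrow→B n ey in S-at (B-value w) (inj₂ (inj₁ w))
  place (narrowCD₀ n) _ true  _ ey = let w = narrow→C n ey in S-at (C-value w) (inj₂ (inj₂ (inj₁ w)))
  place (narrowCD₀ n) _ false _ ey = let w = narrow→D n ey in S-at (D-value w) (inj₂ (inj₂ (inj₂ w)))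
  place (narrowCD₁ n) _ true  _ ey = let w = narrow→C n ey in S-at (C-value w) (inj₂ (inj₂ (inj₁ w)))
  place (narrowCD₁ n) _ false _ ey = let w = narrow→D n ey in S-at (D-value w) (inj₂ (inj₂ (inj₂ w)))
  place (regular reg) false false ex ey = let v = regular-value x p q reg ex ey in S-at v (base₀ x p q ex ey v)
  place (regular reg) false true  ex ey = let v = regular-value x p q reg ex ey in S-at v (base₁ x p q ex ey v)
  place (regular reg) true  true  ex ey = let v = regular-value x p q reg ex ey in S-at v (base₂ x p q ex ey v)
  place (regular reg) true  false ex ey = let v = regular-value x p q reg ex ey in S-at v (base₃ x p q ex ey v)

-- Conversely, a member of a base set outside the exceptional set of its
-- class has the base value: a narrow pair would put it in that set.
EE-value : ∀ {x p q} → EvenEven (position x p q) → ¬ InB (position x p q) → grundy x (odd p) q ≡ 0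
EE-value {x} {p} {q} ee ¬b with EE-parity ee | kind x q
... | ex , ey | regular reg = regular-value x p q reg ex ey
... | ex , ey | narrowAB n  = ⊥-elim (¬b (narrow→B n ey))
... | ex , ey | narrowCD₀ n = ⊥-elim (parity-clash (narrowCD-odd n) ex)
... | ex , ey | narrowCD₁ n = ⊥-elim (parity-clash (narrowCD-odd n) ex)

EO-value : ∀ {x p q} → EvenOdd (position x p q) → ¬ InA (position x p q) → grundy x (odd p) q ≡ 1
EO-value {x} {p} {q} eo ¬a with EO-parity eo | kind x q
... | ex , ey | regular reg = regular-value x p q reg ex ey
... | ex , ey | narrowAB n  = ⊥-elim (¬a (narrow→A n ey))
... | ex , ey | narrowCD₀ n = ⊥-elim (parity-clash (narrowCD-odd n) ex)
... | ex , ey | narrowCD₁ n = ⊥-elim (parity-clash (narrowCD-odd n) ex)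

OO-value : ∀ {x p q} → OddOdd (position x p q) → ¬ InC (position x p q) → grundy x (odd p) q ≡ 2
OO-value {x} {p} {q} oo ¬c with OO-parity oo | kind x q
... | ex , ey | regular reg = regular-value x p q reg ex ey
... | ex , ey | narrowAB n  = ⊥-elim (parity-clash ex (narrowAB-even n))
... | ex , ey | narrowCD₀ n = ⊥-elim (¬c (inj₁ (narrow→C n ey)))
... | ex , ey | narrowCD₁ n = ⊥-elim (¬c (inj₂ (narrow→C n ey)))

OE-value : ∀ {x p q} → OddEven (position x p q) → ¬ InD (position x p q) → grundy x (odd p) q ≡ 3
OE-value {x} {p} {q} oe ¬d with OE-parity oe | kind x q
... | ex , ey | regular reg = regular-value x p q reg ex ey
... | ex , ey | narrowAB n  = ⊥-elim (parity-clash ex (narrowAB-even n))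
... | ex , ey | narrowCD₀ n = ⊥-elim (¬d (inj₂ (narrow→D n ey)))
... | ex , ey | narrowCD₁ n = ⊥-elim (¬d (inj₁ (narrow→D n ey)))

S-value : ∀ {x p q} n → S n (position x p q) → grundy x (odd p) q ≡ n
S-value 0 (inj₁ (ee , ¬b))       = EE-value ee ¬b
S-value 0 (inj₂ (inj₁ w))        = A-value w
S-value 0 (inj₂ (inj₂ (inj₁ w))) = C-value w
S-value 0 (inj₂ (inj₂ (inj₂ w))) = D-value w
S-value 1 (inj₁ (eo , ¬a))       = EO-value eo ¬a
S-value 1 (inj₂ (inj₁ w))        = B-value w
S-value 1 (inj₂ (inj₂ (inj₁ w))) = C-value w
S-value 1 (inj₂ (inj₂ (inj₂ w))) = D-value w
S-value 2 (oo , ¬c)              = OO-value oo ¬c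
S-value 3 (oe , ¬d)              = OE-value oe ¬d

grundy-classification : ∀ x p q →
  (grundy x (odd p) q ≤ 3) × (∀ n → grundy x (odd p) q ≡ n ⇔ S n (position x p q))
grundy-classification x p q =
  S-bounded _ (grundy-in-S x p q) ,
  λ n → mk⇔ (λ v≡n → subst (λ k → S k (position x p q)) v≡n (grundy-in-S x p q)) (S-value n)

proposition10 : (x₁ x₂ x₃ : ℕ) → x₁ ≤ x₂ → x₂ ≤ x₃ →
    (sg x₁ x₂ x₃ ≤ 3)
    × (sg x₁ x₂ x₃ ≡ 0 ⇔ S₀ (x₁ , x₂ , x₃))
    × (sg x₁ x₂ x₃ ≡ 1 ⇔ S₁ (x₁ , x₂ , x₃))
    × (sg x₁ x₂ x₃ ≡ 2 ⇔ S₂ (x₁ , x₂ , x₃))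
    × (sg x₁ x₂ x₃ ≡ 3 ⇔ S₃ (x₁ , x₂ , x₃))
proposition10 x _ _ x≤y y≤z with m≤n⇒∃[o]m+o≡n x≤y | m≤n⇒∃[o]m+o≡n y≤z
... | p , refl | q , refl rewrite sg-sorted x p q refl refl refl =
  let bounded , classified = grundy-classification x p q
  in bounded , classified 0 , classified 1 , classified 2 , classified 3
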